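{- For every finite graph $G$ and every integer $d\ge 1$, we have $\chi(G)\le 2\cdot \chi^d(G\boxtimes K_{d})\le 2\cdot \chi^d(G\boxtimes K_{d+1})$.
   Context: All graphs are finite and simple. $\chi(G)$ denotes the chromatic number of $G$. For an integer $d\ge 0$, a map $c:V(G)\to S$ to a finite set $S$ is a $d$-defective coloring if for every $s\in S$ the induced subgraph $G[c^{ -1}(s)]$ has maximum degree at most $d$ (i.e., every vertex has at most $d$ neighbors of its own color). $\chi^d(G)$ is the minimum $|S|$ for which a $d$-defective coloring of $G$ with color set $S$ exists. For $t\ge 1$, the strong product $G\boxtimes K_t$ is the graph with vertex set $V(G)\times[t]$, where $[t]=\{1,\dots,t\}$, in which distinct vertices $(u,i)$ and $(v,j)$ are adjacent if and only if either $u=v$ (and $i\neq j$) or $uv\in E(G)$. -}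

module Defs where

open import Data.Nat using (ℕ; _≤_; _*_)
open import Data.Fin using (Fin; remQuot)
open import Data.Fin.Properties using (_≟_)
open import Data.Bool using (Bool; true; false; _∧_; _∨_; not; if_then_else_)
open import Data.List using (List; map; allFin)
open import Data.Nat.ListAction using (sum)
open import Data.Product using (Σ; _×_; _,_; proj₁; proj₂)
open import Relation.Binary.PropositionalEquality using (_≡_; _≢_)
open import Relation.Nullary.Decidable using (⌊_⌋)

record Graph : Set where
  field
    size : ℕ
    adj  : Fin size → Fin size → Bool
open Graph public

IsSimple : Graph → Set
IsSimple G = (∀ u v → adj G u v ≡ adj G v u) × (∀ u → adj G u u ≡ false)

IsProperColoring : (G : Graph) (k : ℕ) → (Fin (size G) → Fin k) → Set
IsProperColoring G k c = ∀ u v → adj G u v ≡ true → c u ≢ c v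

Colorable : Graph → ℕ → Set
Colorable G k = Σ (Fin (size G) → Fin k) λ c → IsProperColoring G k c

IsChromaticNumber : Graph → ℕ → Set
IsChromaticNumber G m = Colorable G m × (∀ j → Colorable G j → m ≤ j)

sameColorDegree : (G : Graph) {k : ℕ} → (Fin (size G) → Fin k) → Fin (size G) → ℕ
sameColorDegree G c u =
  sum (map (λ v → if adj G u v ∧ ⌊ c u ≟ c v ⌋ then 1 else 0) (allFin (size G)))

IsDefectiveColoring : (d : ℕ) (G : Graph) (k : ℕ) → (Fin (size G) → Fin k) → Set
IsDefectiveColoring d G k c = ∀ u → sameColorDegree G c u ≤ d

DefColorable : ℕ → Graph → ℕ → Set
DefColorable d G k = Σ (Fin (size G) → Fin k) λ c → IsDefectiveColoring d G k c

IsDefectiveChromaticNumber : ℕ → Graph → ℕ → Set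
IsDefectiveChromaticNumber d G m = DefColorable d G m × (∀ j → DefColorable d G j → m ≤ j)

-- Strong product G ⊠ K_t; vertex set Fin (size G * t) ≅ Fin (size G) × Fin t via remQuot.
_⊠K_ : Graph → ℕ → Graph
size (G ⊠K t) = size G * t
adj (G ⊠K t) x y with remQuot t x | remQuot t y
... | (u , i) | (v , j) = (⌊ u ≟ v ⌋ ∧ not ⌊ i ≟ j ⌋) ∨ adj G u v

-- Let c be a d-defective b-colouring of G ⊠ K_d.  Give every vertex u of G the 2d candidates
-- (f, i), with a flag f ∈ {0, 1} and a copy i of u, and let candidates of adjacent vertices
-- conflict when they carry the same flag and the same c-colour.  As (u, i) has at most d
-- neighbours of its own colour, every candidate has at most d conflicts, so by Haxell's theorem
-- (parts of size 2Δ always have an independent transversal) every vertex can be given a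
-- candidate avoiding all conflicts, and the pair (flag, colour) of that candidate is a proper
-- 2b-colouring of G.  Haxell's theorem is proved by his alternating-tree exchange argument.
-- The second inequality holds because forgetting the last copy of every vertex turns a
-- d-defective colouring of G ⊠ K_(d+1) into one of G ⊠ K_d.
module Submission where

open import Defs
import Algebra.Properties.CommutativeMonoid.Sum as Sum
import Algebra.Properties.Semiring.Sum as SemiringSum
open import Data.Bool using (Bool; true; false; _∧_; _∨_; not; if_then_else_)
import Data.Bool.Properties as Bool
open import Data.Fin using (Fin; zero; suc; fromℕ<; remQuot; combine; inject₁; _↑ˡ_; _↑ʳ_)
import Data.Fin.Properties as Fin
open import Data.Fin.Properties
  using (_≟_; any?; inject₁-injective; remQuot-combine; combine-remQuot;
         combine-injectiveˡ; combine-injectiveʳ)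
open import Data.List using (List; []; _∷_; length; map; allFin; tabulate)
open import Data.List.Properties using (map-tabulate)
open import Data.List.Membership.Propositional.Properties using (∈-allFin)
open import Data.List.Relation.Unary.All as All using (All; []; _∷_)
open import Data.List.Relation.Unary.Any using (Any; here; there)
open import Data.Maybe using (Maybe; just; nothing; maybe)
open import Data.Maybe.Properties using (just-injective)
open import Data.Nat using (ℕ; zero; suc; _+_; _*_; _≤_; _<_; z≤n; s≤s)
import Data.Nat.ListAction as List
open import Data.Nat.Properties hiding (_≟_)
open import Data.Product using (_×_; ∃-syntax; _,_; proj₁; proj₂)
open import Data.Sum as Sum⊎ using (_⊎_; inj₁; inj₂)
open import Function using (id; _∘_)
open import Function.Definitions using (Injective)
open import Relation.Binary.PropositionalEquality
open import Relation.Nullary using (yes; no; ⌊_⌋; contradiction)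
open import Relation.Nullary.Decidable using (_×-dec_)

open Sum +-0-commutativeMonoid
  using (sum; sum-syntax; sum-cong-≗; ∑-distrib-+; ∑-comm; sum-replicate-zero)
open SemiringSum +-*-semiring using (*-distribˡ-sum)

⌊≟⌋-sym : ∀ {m} (i j : Fin m) → ⌊ i ≟ j ⌋ ≡ ⌊ j ≟ i ⌋
⌊≟⌋-sym i j with i ≟ j | j ≟ i
... | yes _   | yes _   = refl
... | no _    | no _    = refl
... | yes i≡j | no j≢i  = contradiction (sym i≡j) j≢i
... | no i≢j  | yes j≡i = contradiction (sym j≡i) i≢j

⌊≟⌋-injective : ∀ {m m'} {f : Fin m → Fin m'} → Injective _≡_ _≡_ f →
                ∀ i j → ⌊ f i ≟ f j ⌋ ≡ ⌊ i ≟ j ⌋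
⌊≟⌋-injective {f = f} f-inj i j with f i ≟ f j | i ≟ j
... | yes _     | yes _   = refl
... | no _      | no _    = refl
... | yes fi≡fj | no i≢j  = contradiction (f-inj fi≡fj) i≢j
... | no fi≢fj  | yes i≡j = contradiction (cong f i≡j) fi≢fj

≡⇒⌊≟⌋ : ∀ {m} {i j : Fin m} → i ≡ j → ⌊ i ≟ j ⌋ ≡ true
≡⇒⌊≟⌋ {i = i} {j} i≡j with i ≟ j
... | yes _   = refl
... | no i≢j = contradiction i≡j i≢j

⌊≟⌋⇒≡ : ∀ {m} {i j : Fin m} → ⌊ i ≟ j ⌋ ≡ true → i ≡ j
⌊≟⌋⇒≡ {i = i} {j} eq with i ≟ j
... | yes i≡j = i≡j
... | no _    = contradiction eq λ ()

⟦_⟧ : Bool → ℕ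
⟦ b ⟧ = if b then 1 else 0

⟦⟧-mono : ∀ {a b} → (a ≡ true → b ≡ true) → ⟦ a ⟧ ≤ ⟦ b ⟧
⟦⟧-mono {false} _   = z≤n
⟦⟧-mono {true}  a⇒b rewrite a⇒b refl = ≤-refl

∑-mono-≤ : ∀ {m} {f g : Fin m → ℕ} → (∀ i → f i ≤ g i) → sum f ≤ sum g
∑-mono-≤ {zero}  f≤g = z≤n
∑-mono-≤ {suc m} f≤g = +-mono-≤ (f≤g zero) (∑-mono-≤ (f≤g ∘ suc))

∑-mono-< : ∀ {m} {f g : Fin m → ℕ} → (∀ i → f i ≤ g i) → ∀ j → f j < g j → sum f < sum g
∑-mono-< f≤g zero    fj<gj = +-mono-<-≤ fj<gj (∑-mono-≤ (f≤g ∘ suc))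
∑-mono-< f≤g (suc j) fj<gj = +-mono-≤-< (f≤g zero) (∑-mono-< (f≤g ∘ suc) j fj<gj)

f≤∑f : ∀ {m} (f : Fin m → ℕ) i → f i ≤ sum f
f≤∑f f zero    = m≤m+n _ _
f≤∑f f (suc i) = ≤-trans (f≤∑f (f ∘ suc) i) (m≤n+m _ (f zero))

∑-const : ∀ m c → ∑[ i < m ] c ≡ m * c
∑-const zero    c = refl
∑-const (suc m) c = cong (c +_) (∑-const m c)

∑-select : ∀ {m} b (j : Fin m) → ∑[ i < m ] ⟦ b ∧ ⌊ j ≟ i ⌋ ⟧ ≡ ⟦ b ⟧
∑-select {suc m} false j       = sum-replicate-zero (suc m)
∑-select {suc m} true  zero    = cong suc (sum-replicate-zero m)
∑-select {suc m} true  (suc j) =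
  trans (sum-cong-≗ (λ i → cong ⟦_⟧ (⌊≟⌋-injective Fin.suc-injective j i))) (∑-select true j)

∑-split : ∀ m k (h : Fin (m + k) → ℕ) → sum h ≡ sum (h ∘ (_↑ˡ k)) + sum (h ∘ (m ↑ʳ_))
∑-split zero    k h = refl
∑-split (suc m) k h = trans (cong (h zero +_) (∑-split m k (h ∘ suc))) (sym (+-assoc (h zero) _ _))

∑-combine : ∀ m k (h : Fin (m * k) → ℕ) → sum h ≡ ∑[ u < m ] ∑[ j < k ] h (combine u j)
∑-combine zero    k h = refl
∑-combine (suc m) k h =
  trans (∑-split k (m * k) h)
        (cong (sum (h ∘ combine {suc m} zero) +_) (∑-combine m k (h ∘ (k ↑ʳ_))))

∑-inject₁-≤ : ∀ {m} (h : Fin (suc m) → ℕ) → sum (h ∘ inject₁) ≤ sum h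
∑-inject₁-≤ {zero}  h = z≤n
∑-inject₁-≤ {suc m} h = +-monoʳ-≤ (h zero) (∑-inject₁-≤ (h ∘ suc))

sum-map-allFin : ∀ m (f : Fin m → ℕ) → List.sum (map f (allFin m)) ≡ sum f
sum-map-allFin m f = trans (cong List.sum (map-tabulate id f)) (sum-tabulate m f)
  where
  sum-tabulate : ∀ m (f : Fin m → ℕ) → List.sum (tabulate f) ≡ sum f
  sum-tabulate zero    f = refl
  sum-tabulate (suc m) f = cong (f zero +_) (sum-tabulate m (f ∘ suc))

∑-insert : ∀ {m} (A : Fin m → Bool) p → A p ≡ false →
           ∑[ i < m ] ⟦ A i ∨ ⌊ p ≟ i ⌋ ⟧ ≡ suc (∑[ i < m ] ⟦ A i ⟧)
∑-insert {m} A p Ap≡false = begin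
  ∑[ i < m ] ⟦ A i ∨ ⌊ p ≟ i ⌋ ⟧                ≡⟨ sum-cong-≗ split ⟩
  ∑[ i < m ] (⟦ A i ⟧ + ⟦ ⌊ p ≟ i ⌋ ⟧)          ≡⟨ ∑-distrib-+ (⟦_⟧ ∘ A) _ ⟩
  ∑[ i < m ] ⟦ A i ⟧ + ∑[ i < m ] ⟦ ⌊ p ≟ i ⌋ ⟧ ≡⟨ cong (sum (⟦_⟧ ∘ A) +_) (∑-select true p) ⟩
  ∑[ i < m ] ⟦ A i ⟧ + 1                        ≡⟨ +-comm _ 1 ⟩
  suc (∑[ i < m ] ⟦ A i ⟧)                      ∎
  where
  open ≡-Reasoning
  split : ∀ i → ⟦ A i ∨ ⌊ p ≟ i ⌋ ⟧ ≡ ⟦ A i ⟧ + ⟦ ⌊ p ≟ i ⌋ ⟧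
  split i with p ≟ i
  ... | yes refl rewrite Ap≡false = refl
  ... | no _ with A i
  ...   | true  = refl
  ...   | false = refl

∑-insert-∁ : ∀ {m} (A : Fin m → Bool) p → A p ≡ false →
             suc (∑[ i < m ] ⟦ not (A i ∨ ⌊ p ≟ i ⌋) ⟧) ≡ ∑[ i < m ] ⟦ not (A i) ⟧
∑-insert-∁ {m} A p Ap≡false = begin
  suc (∑[ i < m ] ⟦ B i ⟧)                      ≡⟨ +-comm 1 _ ⟩
  ∑[ i < m ] ⟦ B i ⟧ + 1                        ≡⟨ cong (sum (⟦_⟧ ∘ B) +_) (∑-select true p) ⟨
  ∑[ i < m ] ⟦ B i ⟧ + ∑[ i < m ] ⟦ ⌊ p ≟ i ⌋ ⟧ ≡⟨ ∑-distrib-+ (⟦_⟧ ∘ B) _ ⟨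
  ∑[ i < m ] (⟦ B i ⟧ + ⟦ ⌊ p ≟ i ⌋ ⟧)          ≡⟨ sum-cong-≗ merge ⟩
  ∑[ i < m ] ⟦ not (A i) ⟧                      ∎
  where
  open ≡-Reasoning
  B : Fin m → Bool
  B i = not (A i ∨ ⌊ p ≟ i ⌋)
  merge : ∀ i → ⟦ B i ⟧ + ⟦ ⌊ p ≟ i ⌋ ⟧ ≡ ⟦ not (A i) ⟧
  merge i with p ≟ i
  ... | yes refl rewrite Ap≡false = refl
  ... | no _ with A i
  ...   | true  = refl
  ...   | false = refl

∑-sum-map : ∀ {A : Set} {m} (L : List A) (f : A → Fin m → ℕ) →
            ∑[ i < m ] List.sum (map (λ a → f a i) L) ≡ List.sum (map (λ a → ∑[ i < m ] f a i) L)
∑-sum-map {m = m} []      f = sum-replicate-zero m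
∑-sum-map         (a ∷ L) f = trans (∑-distrib-+ (f a) _) (cong (sum (f a) +_) (∑-sum-map L f))

sum-map-≤ : ∀ {A : Set} (L : List A) {f : A → ℕ} {c} → (∀ a → f a ≤ c) →
            List.sum (map f L) ≤ length L * c
sum-map-≤ []      f≤c = z≤n
sum-map-≤ (a ∷ L) f≤c = +-mono-≤ (f≤c a) (sum-map-≤ L f≤c)

sum-map-≡0 : ∀ {A : Set} (L : List A) {f : A → ℕ} → List.sum (map f L) ≡ 0 → All (λ a → f a ≡ 0) L
sum-map-≡0 []      _  = []
sum-map-≡0 (a ∷ L) eq = m+n≡0⇒m≡0 _ eq ∷ sum-map-≡0 L (m+n≡0⇒n≡0 _ eq)

module IndependentTransversal
  {n k Δ : ℕ} (_∼_ : Fin n × Fin k → Fin n × Fin k → Bool)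
  (∼-sym : ∀ x y → x ∼ y ≡ y ∼ x)
  (∼-part : ∀ p o o′ → (p , o) ∼ (p , o′) ≡ false)
  (deg≤Δ : ∀ x → ∑[ p < n ] ∑[ o < k ] ⟦ x ∼ (p , o) ⟧ ≤ Δ)
  (2Δ≤k : Δ + Δ ≤ k) (0<k : 0 < k)
  where

  Node : Set
  Node = Fin n × Fin k

  part : Node → Fin n
  part = proj₁

  Partial : Set
  Partial = Fin n → Maybe (Fin k)

  infix 4 _∈_ _⊑_
  infixl 6 _[_≔_]

  _∈_ : Node → Partial → Set
  (p , o) ∈ M = M p ≡ just o

  Independent : Partial → Set
  Independent M = ∀ {x y} → x ∈ M → y ∈ M → x ∼ y ≡ false

  Defined : Partial → Fin n → Set
  Defined M p = ∃[ o ] M p ≡ just o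

  _⊑_ : Partial → Partial → Set
  M ⊑ M′ = ∀ p → Defined M p → Defined M′ p

  ⊑-trans : ∀ {M M′ M″} → M ⊑ M′ → M′ ⊑ M″ → M ⊑ M″
  ⊑-trans M⊑M′ M′⊑M″ p = M′⊑M″ p ∘ M⊑M′ p

  conflicts : Partial → Node → Fin n → Bool
  conflicts M x p = maybe (λ o → x ∼ (p , o)) false (M p)

  load : Partial → Node → ℕ
  load M x = ∑[ p < n ] ⟦ conflicts M x p ⟧

  conflicts-true : ∀ M x p → conflicts M x p ≡ true → ∃[ o ] M p ≡ just o × x ∼ (p , o) ≡ true
  conflicts-true M x p hit with M p
  ... | just o = o , refl , hit

  conflicts-∈ : ∀ {M x p o} → M p ≡ just o → conflicts M x p ≡ x ∼ (p , o)
  conflicts-∈ Mp≡o rewrite Mp≡o = refl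

  _[_≔_] : Partial → Fin n → Fin k → Partial
  (M [ q ≔ o ]) p = if ⌊ q ≟ p ⌋ then just o else M p

  ≔-≡ : ∀ M q o → (M [ q ≔ o ]) q ≡ just o
  ≔-≡ M q o with q ≟ q
  ... | yes _   = refl
  ... | no q≢q = contradiction refl q≢q

  ≔-≢ : ∀ M {q p} o → q ≢ p → (M [ q ≔ o ]) p ≡ M p
  ≔-≢ M {q} {p} o q≢p with q ≟ p
  ... | yes q≡p = contradiction q≡p q≢p
  ... | no _    = refl

  ∈-≔ : ∀ M q o {x} → x ∈ M [ q ≔ o ] → x ≡ (q , o) ⊎ x ∈ M
  ∈-≔ M q o {p , o′} x∈ with q ≟ p
  ... | yes refl = inj₁ (cong (q ,_) (sym (just-injective x∈)))
  ... | no _     = inj₂ x∈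

  ∈-unique : ∀ {M y p o} → y ∈ M → part y ≡ p → M p ≡ just o → y ≡ (p , o)
  ∈-unique {y = p , o′} y∈M refl Mp≡o = cong (p ,_) (just-injective (trans (sym y∈M) Mp≡o))

  ≔-independent : ∀ {M q o} → Independent M → (∀ {y} → y ∈ M → (q , o) ∼ y ≡ false) →
                  Independent (M [ q ≔ o ])
  ≔-independent {M} {q} {o} indep free x∈ y∈ with ∈-≔ M q o x∈ | ∈-≔ M q o y∈
  ... | inj₁ refl | inj₁ refl = ∼-part q o o
  ... | inj₁ refl | inj₂ y∈M  = free y∈M
  ... | inj₂ x∈M  | inj₁ refl = trans (∼-sym _ _) (free x∈M)
  ... | inj₂ x∈M  | inj₂ y∈M  = indep x∈M y∈M

  ⊑-≔ : ∀ M q o → M ⊑ M [ q ≔ o ]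
  ⊑-≔ M q o p (o′ , Mp≡o′) with q ≟ p
  ... | yes _ = o , refl
  ... | no _  = o′ , Mp≡o′

  ≔-conflicts-≤ : ∀ M {q o} z → z ∼ (q , o) ≡ false →
                  ∀ p → ⟦ conflicts (M [ q ≔ o ]) z p ⟧ ≤ ⟦ conflicts M z p ⟧
  ≔-conflicts-≤ M {q} z z≁qo p with q ≟ p
  ... | yes refl rewrite z≁qo = z≤n
  ... | no _     = ≤-refl

  ≔-load-≤ : ∀ M {q o} z → z ∼ (q , o) ≡ false → load (M [ q ≔ o ]) z ≤ load M z
  ≔-load-≤ M z z≁qo = ∑-mono-≤ (≔-conflicts-≤ M z z≁qo)

  ≔-load-< : ∀ M {q o o′} z → z ∼ (q , o) ≡ false → M q ≡ just o′ → z ∼ (q , o′) ≡ true →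
             load (M [ q ≔ o ]) z < load M z
  ≔-load-< M {q} {o} z z≁qo Mq≡o′ z∼qo′ = ∑-mono-< (≔-conflicts-≤ M z z≁qo) q strict
    where
    strict : ⟦ conflicts (M [ q ≔ o ]) z q ⟧ < ⟦ conflicts M z q ⟧
    strict rewrite ≔-≡ M q o | Mq≡o′ | z≁qo | z∼qo′ = s≤s z≤n

  record Link : Set where
    constructor _⇝_
    field
      from to : Node
  open Link

  Avoids : Node → Link → Set
  Avoids x e = from e ∼ x ≡ false × to e ∼ x ≡ false

  record Valid (M : Partial) (I : Fin n → Bool) (e : Link) : Set where
    field
      to∈I    : I (part (to e)) ≡ true
      to∈M    : to e ∈ M
      from∼to : from e ∼ to e ≡ true
  open Valid

  hits : List Link → Node → ℕ
  hits D w = List.sum (map (λ e → ⟦ from e ∼ w ∨ to e ∼ w ⟧) D)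

  hits≡0 : ∀ D w → hits D w ≡ 0 → All (Avoids w) D
  hits≡0 D w = All.map avoids ∘ sum-map-≡0 D
    where
    avoids : ∀ {e} → ⟦ from e ∼ w ∨ to e ∼ w ⟧ ≡ 0 → Avoids w e
    avoids {e} eq with from e ∼ w | to e ∼ w
    ... | false | false = refl , refl

  ∑-hits≤ : ∀ D → ∑[ p < n ] ∑[ o < k ] hits D (p , o) ≤ length D * (Δ + Δ)
  ∑-hits≤ D = begin
    ∑[ p < n ] ∑[ o < k ] hits D (p , o)
      ≡⟨ sum-cong-≗ (λ p → ∑-sum-map D (λ e o → h e (p , o))) ⟩
    ∑[ p < n ] List.sum (map (λ e → ∑[ o < k ] h e (p , o)) D)
      ≡⟨ ∑-sum-map D (λ e p → ∑[ o < k ] h e (p , o)) ⟩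
    List.sum (map (λ e → ∑[ p < n ] ∑[ o < k ] h e (p , o)) D)
      ≤⟨ sum-map-≤ D h≤2Δ ⟩
    length D * (Δ + Δ) ∎
    where
    open ≤-Reasoning
    h : Link → Node → ℕ
    h e w = ⟦ from e ∼ w ∨ to e ∼ w ⟧
    ∨≤+ : ∀ a b → ⟦ a ∨ b ⟧ ≤ ⟦ a ⟧ + ⟦ b ⟧
    ∨≤+ true  b = s≤s z≤n
    ∨≤+ false b = ≤-refl
    h≤2Δ : ∀ e → ∑[ p < n ] ∑[ o < k ] h e (p , o) ≤ Δ + Δ
    h≤2Δ e = begin
      ∑[ p < n ] ∑[ o < k ] h e (p , o)
        ≤⟨ ∑-mono-≤ (λ p → ∑-mono-≤ (λ o → ∨≤+ (from e ∼ (p , o)) (to e ∼ (p , o)))) ⟩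
      ∑[ p < n ] ∑[ o < k ] (⟦ from e ∼ (p , o) ⟧ + ⟦ to e ∼ (p , o) ⟧)
        ≡⟨ sum-cong-≗ (λ p → ∑-distrib-+ (λ o → ⟦ from e ∼ (p , o) ⟧) (λ o → ⟦ to e ∼ (p , o) ⟧)) ⟩
      ∑[ p < n ] (∑[ o < k ] ⟦ from e ∼ (p , o) ⟧ + ∑[ o < k ] ⟦ to e ∼ (p , o) ⟧)
        ≡⟨ ∑-distrib-+ (λ p → ∑[ o < k ] ⟦ from e ∼ (p , o) ⟧) _ ⟩
      ∑[ p < n ] ∑[ o < k ] ⟦ from e ∼ (p , o) ⟧ + ∑[ p < n ] ∑[ o < k ] ⟦ to e ∼ (p , o) ⟧
        ≤⟨ +-mono-≤ (deg≤Δ (from e)) (deg≤Δ (to e)) ⟩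
      Δ + Δ ∎

  -- Pigeonhole: the parts in I offer k · |I| nodes, while each of the 2 |D| link ends
  -- conflicts with at most Δ of them.
  avoiding-node : ∀ (I : Fin n → Bool) D → length D * (Δ + Δ) < k * ∑[ p < n ] ⟦ I p ⟧ →
                  ∃[ w ] I (part w) ≡ true × All (Avoids w) D
  avoiding-node I D fits
    with any? (λ p → any? (λ o → I p Bool.≟ true ×-dec hits D (p , o) Data.Nat.≟ 0))
  ... | yes (p , o , p∈I , free) = (p , o) , p∈I , hits≡0 D (p , o) free
  ... | no none = contradiction fits (≤⇒≯ (begin
    k * ∑[ p < n ] ⟦ I p ⟧         ≡⟨ *-distribˡ-sum k (λ p → ⟦ I p ⟧) ⟩
    ∑[ p < n ] (k * ⟦ I p ⟧)       ≡⟨ sum-cong-≗ (λ p → ∑-const k ⟦ I p ⟧) ⟨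
    ∑[ p < n ] ∑[ o < k ] ⟦ I p ⟧ ≤⟨ ∑-mono-≤ (λ p → ∑-mono-≤ (λ o → I⊆hit p o)) ⟩
    ∑[ p < n ] ∑[ o < k ] hits D (p , o) ≤⟨ ∑-hits≤ D ⟩
    length D * (Δ + Δ)             ∎))
    where
    open ≤-Reasoning
    I⊆hit : ∀ p o → ⟦ I p ⟧ ≤ hits D (p , o)
    I⊆hit p o with I p in p∈I
    ... | false = z≤n
    ... | true  = n≢0⇒n>0 (λ free → none (p , o , p∈I , free))

  -- Haxell's alternating tree grown from the uncovered part u₀; x is the node of a reached part
  -- that we are trying to add to M.
  record Tree (u₀ : Fin n) (r : ℕ) (D : List Link) (I : Fin n → Bool) (x : Node) (M : Partial)
              : Set where
    field
      independent : Independent M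
      u₀-free     : M u₀ ≡ nothing
      |I|         : ∑[ p < n ] ⟦ I p ⟧ ≡ suc (length D)
      |∁I|        : ∑[ p < n ] ⟦ not (I p) ⟧ ≡ r
      I-reached   : ∀ p → I p ≡ true → p ≡ u₀ ⊎ Any (λ e → part (to e) ≡ p) D
      valid       : All (Valid M I) D
      avoids      : All (Avoids x) D
      x∈I         : I (part x) ≡ true
  open Tree

  record Improves (M M′ : Partial) (q : Fin n) (e : Link) : Set where
    field
      load-≤ : load M′ (from e) ≤ load M (from e)
      kept   : part (to e) ≢ q → to e ∈ M′
      load-< : part (to e) ≡ q → load M′ (from e) < load M (from e)
  open Improves

  data Outcome (u₀ : Fin n) (M : Partial) (D : List Link) : Set where
    extended  : ∀ M′ → Independent M′ → Defined M′ u₀ → M ⊑ M′ → Outcome u₀ M D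
    exchanged : ∀ M′ q → Independent M′ → M′ u₀ ≡ nothing → M ⊑ M′ →
                Any (λ e → part (to e) ≡ q) D → All (Improves M M′ q) D → Outcome u₀ M D

  ≔-quiet-independent : ∀ {M x} → Independent M → (∀ p → conflicts M x p ≡ false) →
                        Independent (M [ part x ≔ proj₂ x ])
  ≔-quiet-independent {M} {x} indep quiet =
    ≔-independent indep (λ {y} y∈M → trans (sym (conflicts-∈ {M} {x} y∈M)) (quiet (part y)))

  settle : ∀ {u₀ r D I x M} → Tree u₀ r D I x M → (∀ p → conflicts M x p ≡ false) → Outcome u₀ M D
  settle {u₀} {x = q , o} {M} T quiet with q ≟ u₀
  ... | yes refl = extended (M [ q ≔ o ]) (≔-quiet-independent (independent T) quiet)
                     (o , ≔-≡ M q o) (⊑-≔ M q o)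
  ... | no q≢u₀ with I-reached T q (x∈I T)
  ...   | inj₁ q≡u₀    = contradiction q≡u₀ q≢u₀
  ...   | inj₂ reached = exchanged (M [ q ≔ o ]) q (≔-quiet-independent (independent T) quiet)
                           (trans (≔-≢ M o q≢u₀) (u₀-free T)) (⊑-≔ M q o) reached
                           (All.zipWith improves (valid T , avoids T))
    where
    improves : ∀ {I e} → Valid M I e × Avoids (q , o) e → Improves M (M [ q ≔ o ]) q e
    improves (v , from≁x , _) = record
      { load-≤ = ≔-load-≤ M _ from≁x
      ; kept   = λ p≢q → trans (≔-≢ M o (p≢q ∘ sym)) (to∈M v)
      ; load-< = λ { refl → ≔-load-< M _ from≁x (to∈M v) (from∼to v) } }

  -- Such a node is neither at u₀ (which is free) nor a link target (which x avoids).
  conflict-outside : ∀ {u₀ r D I x M p o} → Tree u₀ r D I x M → M p ≡ just o → x ∼ (p , o) ≡ true →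
                     I p ≡ false
  conflict-outside {u₀} {I = I} {x} {M} {p} {o} T Mp≡o x∼po with I p in p∈I
  ... | false = refl
  ... | true with I-reached T p p∈I
  ...   | inj₁ refl    = contradiction (trans (sym Mp≡o) (u₀-free T)) λ ()
  ...   | inj₂ reached with All.lookupAny (All.zip (valid T , avoids T)) reached
  ...     | (v , _ , to≁x) , at-p = contradiction (trans (sym x∼po) x≁po) λ ()
    where
    x≁po : x ∼ (p , o) ≡ false
    x≁po = trans (∼-sym x (p , o))
                 (subst (λ y → y ∼ x ≡ false) (∈-unique {M} (to∈M v) at-p Mp≡o) to≁x)

  exhausted : ∀ {u₀ D I x M p} → Tree u₀ zero D I x M → I p ≢ false
  exhausted {I = I} {p = p} T p∉I = n≮0 (begin
    ⟦ not false ⟧              ≡⟨ cong (⟦_⟧ ∘ not) p∉I ⟨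
    ⟦ not (I p) ⟧              ≤⟨ f≤∑f (λ p′ → ⟦ not (I p′) ⟧) p ⟩
    ∑[ p′ < n ] ⟦ not (I p′) ⟧ ≡⟨ |∁I| T ⟩
    0                          ∎)
    where open ≤-Reasoning

  insert : (Fin n → Bool) → Fin n → Fin n → Bool
  insert I p p′ = I p′ ∨ ⌊ p ≟ p′ ⌋

  links-fit : ∀ m → m * (Δ + Δ) < k * suc m
  links-fit m = begin-strict
    m * (Δ + Δ) ≤⟨ *-monoʳ-≤ m 2Δ≤k ⟩
    m * k       ≡⟨ *-comm m k ⟩
    k * m       <⟨ m<n+m (k * m) 0<k ⟩
    k + k * m   ≡⟨ *-suc k m ⟨
    k * suc m   ∎
    where open ≤-Reasoning

  grow : ∀ {u₀ r D I x M p o} → Tree u₀ (suc r) D I x M → M p ≡ just o → x ∼ (p , o) ≡ true →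
         ∃[ w ] Tree u₀ r (x ⇝ (p , o) ∷ D) (insert I p) w M
  grow {u₀} {r} {D} {I} {x} {M} {p} {o} T Mp≡o x∼po = w , record
    { independent = independent T
    ; u₀-free     = u₀-free T
    ; |I|         = |I′|
    ; |∁I|        = suc-injective (trans (∑-insert-∁ I p p∉I) (|∁I| T))
    ; I-reached   = reached
    ; valid       = record { to∈I = p∈I′ ; to∈M = Mp≡o ; from∼to = x∼po }
                    ∷ All.map widen (valid T)
    ; avoids      = proj₂ (proj₂ found)
    ; x∈I         = proj₁ (proj₂ found) }
    where
    p∉I : I p ≡ false
    p∉I = conflict-outside T Mp≡o x∼po
    D′ : List Link
    D′ = x ⇝ (p , o) ∷ D
    |I′| : ∑[ p′ < n ] ⟦ insert I p p′ ⟧ ≡ suc (length D′)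
    |I′| = trans (∑-insert I p p∉I) (cong suc (|I| T))
    found : ∃[ w ] insert I p (part w) ≡ true × All (Avoids w) D′
    found = avoiding-node (insert I p) D′
              (subst (λ c → length D′ * (Δ + Δ) < k * c) (sym |I′|) (links-fit (length D′)))
    w : Node
    w = proj₁ found
    widen : ∀ {e} → Valid M I e → Valid M (insert I p) e
    widen v = record { to∈I = ∨-inj₁ (to∈I v) ; to∈M = to∈M v ; from∼to = from∼to v }
      where
      ∨-inj₁ : ∀ {a b} → a ≡ true → a ∨ b ≡ true
      ∨-inj₁ refl = refl
    p∈I′ : insert I p p ≡ true
    p∈I′ rewrite p∉I | ≡⇒⌊≟⌋ {i = p} refl = refl
    reached : ∀ p′ → insert I p p′ ≡ true → p′ ≡ u₀ ⊎ Any (λ e → part (to e) ≡ p′) D′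
    reached p′ p′∈I′ with p ≟ p′ | I p′ in p′∈I
    ... | yes refl | _     = inj₂ (here refl)
    ... | no _     | true  = Sum⊎.map₂ there (I-reached T p′ p′∈I)
    ... | no _     | false = contradiction p′∈I′ λ ()

  retarget : ∀ {u₀ M M″ D} → M ⊑ M″ → All (λ e → load M″ (from e) ≤ load M (from e)) D →
             Outcome u₀ M″ D → Outcome u₀ M D
  retarget M⊑M″ _ (extended M′ indep def M″⊑M′) = extended M′ indep def (⊑-trans M⊑M″ M″⊑M′)
  retarget {M = M} {M″} M⊑M″ lowered (exchanged M′ q indep free M″⊑M′ reached improves) =
    exchanged M′ q indep free (⊑-trans M⊑M″ M″⊑M′) reached (All.zipWith chain (lowered , improves))
    where
    chain : ∀ {e} → load M″ (from e) ≤ load M (from e) × Improves M″ M′ q e → Improves M M′ q e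
    chain (≤M , imp) = record
      { load-≤ = ≤-trans (load-≤ imp) ≤M
      ; kept   = kept imp
      ; load-< = λ at-q → <-≤-trans (load-< imp at-q) ≤M }

  conflict? : ∀ M x → (∀ p → conflicts M x p ≡ false) ⊎
                      ∃[ p ] ∃[ o ] M p ≡ just o × x ∼ (p , o) ≡ true
  conflict? M x with any? (λ p → conflicts M x p Bool.≟ true)
  ... | yes (p , hit) = inj₂ (p , conflicts-true M x p hit)
  ... | no quiet      = inj₁ (λ p → Bool.¬-not (quiet ∘ (p ,_)))

  Search : ℕ → Set
  Search r = ∀ {u₀ D I x M} → Tree u₀ r D I x M → Outcome u₀ M D

  -- Each round either grows the tree, handled by the search one level down, or comes back
  -- with an exchange that strictly lowers the load of x.
  improve : ∀ {r} → Search r → ∀ acc {u₀ D I x M} → Tree u₀ (suc r) D I x M → load M x < acc →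
            Outcome u₀ M D
  improve {r} deeper (suc acc) {u₀} {D} {I} {x} {M} T (s≤s load≤acc) with conflict? M x
  ... | inj₁ quiet                   = settle T quiet
  ... | inj₂ (p , o , Mp≡o , x∼po) with deeper (proj₂ (grow T Mp≡o x∼po))
  ... | extended M′ indep def M⊑M′ = extended M′ indep def M⊑M′
  ... | exchanged M′ q indep free M⊑M′ (there reached) (_ ∷ improves) =
    exchanged M′ q indep free M⊑M′ reached improves
  ... | exchanged M″ q indep free M⊑M″ (here p≡q) (improves-x ∷ improves) =
    retarget M⊑M″ (All.map load-≤ improves)
      (improve deeper acc T″ (<-≤-trans (load-< improves-x p≡q) load≤acc))
    where
    T″ : Tree u₀ (suc r) D I x M″
    T″ = record
      { independent = indep
      ; u₀-free     = free
      ; |I|         = |I| T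
      ; |∁I|        = |∁I| T
      ; I-reached   = I-reached T
      ; valid       = All.zipWith restore (valid T , improves)
      ; avoids      = avoids T
      ; x∈I         = x∈I T }
      where
      restore : ∀ {e} → Valid M I e × Improves M M″ q e → Valid M″ I e
      restore (v , imp) = record
        { to∈I    = to∈I v
        ; to∈M    = kept imp (λ at-q → contradiction (trans (sym (to∈I v))
                      (trans (cong I (trans at-q (sym p≡q))) (conflict-outside T Mp≡o x∼po))) λ ())
        ; from∼to = from∼to v }

  search : ∀ r → Search r
  search zero {x = x} {M} T with conflict? M x
  ... | inj₁ quiet                   = settle T quiet
  ... | inj₂ (_ , _ , Mp≡o , x∼po) = contradiction (conflict-outside T Mp≡o x∼po) (exhausted T)
  search (suc r) {x = x} {M} T = improve (search r) (suc (load M x)) T ≤-refl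

  root : ∀ {M u₀} → Independent M → M u₀ ≡ nothing →
         Tree u₀ (∑[ p < n ] ⟦ not ⌊ u₀ ≟ p ⌋ ⟧) [] (λ p → ⌊ u₀ ≟ p ⌋) (u₀ , fromℕ< 0<k) M
  root {u₀ = u₀} indep free = record
    { independent = indep
    ; u₀-free     = free
    ; |I|         = ∑-select true u₀
    ; |∁I|        = refl
    ; I-reached   = λ p u₀≡p → inj₁ (sym (⌊≟⌋⇒≡ u₀≡p))
    ; valid       = []
    ; avoids      = []
    ; x∈I         = ≡⇒⌊≟⌋ refl }

  extend : ∀ {M u₀} → Independent M → M u₀ ≡ nothing →
           ∃[ M′ ] Independent M′ × Defined M′ u₀ × M ⊑ M′
  extend indep free with search _ (root indep free)
  ... | extended M′ indep′ def M⊑M′ = M′ , indep′ , def , M⊑M′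

  cover : (L : List (Fin n)) → ∃[ M ] Independent M × All (Defined M) L
  cover []      = (λ _ → nothing) , (λ ()) , []
  cover (u ∷ L) with cover L
  ... | M , indep , defined with M u in Mu
  ...   | just o  = M , indep , (o , Mu) ∷ defined
  ...   | nothing with extend indep Mu
  ...     | M′ , indep′ , def , M⊑M′ = M′ , indep′ , def ∷ All.map (M⊑M′ _) defined

  independent-transversal : ∃[ F ] ∀ p q → (p , F p) ∼ (q , F q) ≡ false
  independent-transversal = F , λ p q → indep (proj₂ (chosen p)) (proj₂ (chosen q))
    where
    covered = cover (allFin n)
    indep = proj₁ (proj₂ covered)
    chosen : ∀ p → Defined (proj₁ covered) p
    chosen p = All.lookup (proj₂ (proj₂ covered)) (∈-allFin p)
    F : Fin n → Fin k
    F = proj₁ ∘ chosen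

adj-⊠ : ∀ G t (u v : Fin (size G)) (i j : Fin t) →
        adj (G ⊠K t) (combine u i) (combine v j) ≡ (⌊ u ≟ v ⌋ ∧ not ⌊ i ≟ j ⌋) ∨ adj G u v
adj-⊠ G t u v i j = cong₂ adjᵖ (remQuot-combine u i) (remQuot-combine v j)
  where
  adjᵖ : Fin (size G) × Fin t → Fin (size G) × Fin t → Bool
  adjᵖ (u , i) (v , j) = (⌊ u ≟ v ⌋ ∧ not ⌊ i ≟ j ⌋) ∨ adj G u v

sameColorDegree-⊠ : ∀ G t {k} (c : Fin (size G * t) → Fin k) x →
  sameColorDegree (G ⊠K t) c x ≡
  ∑[ v < size G ] ∑[ j < t ] ⟦ adj (G ⊠K t) x (combine v j) ∧ ⌊ c x ≟ c (combine v j) ⌋ ⟧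
sameColorDegree-⊠ G t c x = trans (sum-map-allFin _ same) (∑-combine (size G) t same)
  where
  same : Fin (size G * t) → ℕ
  same y = ⟦ adj (G ⊠K t) x y ∧ ⌊ c x ≟ c y ⌋ ⟧

∀-combine : ∀ {m t} {P : Fin (m * t) → Set} → (∀ u i → P (combine u i)) → ∀ x → P x
∀-combine {m} {t} {P} P-combine x =
  subst P (combine-remQuot {m} t x) (P-combine (proj₁ (remQuot {m} t x)) (proj₂ (remQuot {m} t x)))

restrict : ∀ {m t k} → (Fin (m * suc t) → Fin k) → Fin (m * t) → Fin k
restrict {m} {t} c x = c (combine (proj₁ (remQuot {m} t x)) (inject₁ (proj₂ (remQuot {m} t x))))

restrict-combine : ∀ {m t k} (c : Fin (m * suc t) → Fin k) (u : Fin m) (i : Fin t) →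
                   restrict {m} c (combine u i) ≡ c (combine u (inject₁ i))
restrict-combine c u i = cong (λ (v , j) → c (combine v (inject₁ j))) (remQuot-combine u i)

defColorable-⊠K-mono : ∀ d G t k → DefColorable d (G ⊠K suc t) k → DefColorable d (G ⊠K t) k
defColorable-⊠K-mono d G t k (c , c-def) =
  c↾ , ∀-combine {P = λ x → sameColorDegree (G ⊠K t) c↾ x ≤ d} same≤d
  where
  c↾ : Fin (size G * t) → Fin k
  c↾ = restrict {size G} c
  h : Fin (size G) → Fin t → Fin (size G) → Fin (suc t) → ℕ
  h u i v j = ⟦ adj (G ⊠K suc t) (combine u (inject₁ i)) (combine v j)
              ∧ ⌊ c (combine u (inject₁ i)) ≟ c (combine v j) ⌋ ⟧
  adj-inject₁ : ∀ u v i j → adj (G ⊠K t) (combine u i) (combine v j)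
                          ≡ adj (G ⊠K suc t) (combine u (inject₁ i)) (combine v (inject₁ j))
  adj-inject₁ u v i j = begin
    adj (G ⊠K t) (combine u i) (combine v j)              ≡⟨ adj-⊠ G t u v i j ⟩
    (⌊ u ≟ v ⌋ ∧ not ⌊ i ≟ j ⌋) ∨ adj G u v
      ≡⟨ cong (λ b → (⌊ u ≟ v ⌋ ∧ not b) ∨ adj G u v) (⌊≟⌋-injective inject₁-injective i j) ⟨
    (⌊ u ≟ v ⌋ ∧ not ⌊ inject₁ i ≟ inject₁ j ⌋) ∨ adj G u v ≡⟨ adj-⊠ G (suc t) u v _ _ ⟨
    adj (G ⊠K suc t) (combine u (inject₁ i)) (combine v (inject₁ j)) ∎
    where open ≡-Reasoning
  same≤d : ∀ u i → sameColorDegree (G ⊠K t) c↾ (combine u i) ≤ d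
  same≤d u i = begin
    sameColorDegree (G ⊠K t) c↾ (combine u i)
      ≡⟨ sameColorDegree-⊠ G t _ _ ⟩
    ∑[ v < size G ] ∑[ j < t ] ⟦ adj (G ⊠K t) (combine u i) (combine v j)
                                 ∧ ⌊ c↾ (combine u i) ≟ c↾ (combine v j) ⌋ ⟧
      ≡⟨ sum-cong-≗ (λ v → sum-cong-≗ (λ j → cong ⟦_⟧ (cong₂ _∧_ (adj-inject₁ u v i j)
           (cong₂ (λ a b → ⌊ a ≟ b ⌋) (restrict-combine c u i) (restrict-combine c v j))))) ⟩
    ∑[ v < size G ] ∑[ j < t ] h u i v (inject₁ j)
      ≤⟨ ∑-mono-≤ (λ v → ∑-inject₁-≤ (h u i v)) ⟩
    ∑[ v < size G ] ∑[ j < suc t ] h u i v j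
      ≡⟨ sameColorDegree-⊠ G (suc t) c _ ⟨
    sameColorDegree (G ⊠K suc t) c (combine u (inject₁ i))
      ≤⟨ c-def _ ⟩
    d ∎
    where open ≤-Reasoning

defColorable-⊠K⇒colorable : ∀ G → IsSimple G → ∀ d t b → d ≤ t → 0 < t →
                             DefColorable d (G ⊠K t) b → Colorable G (2 * b)
defColorable-⊠K⇒colorable G (adj-sym , adj-irrefl) d t b d≤t 0<t (c , c-def) = colour , proper
  where
  n : ℕ
  n = size G
  flag : Fin (2 * t) → Fin 2
  flag o = proj₁ (remQuot {2} t o)
  copy : Fin (2 * t) → Fin t
  copy o = proj₂ (remQuot {2} t o)
  shade : Fin n × Fin (2 * t) → Fin b
  shade (u , o) = c (combine u (copy o))

  _∼_ : Fin n × Fin (2 * t) → Fin n × Fin (2 * t) → Bool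
  (u , o) ∼ (v , o′) = (adj G u v ∧ ⌊ shade (u , o) ≟ shade (v , o′) ⌋) ∧ ⌊ flag o ≟ flag o′ ⌋

  ∼-sym : ∀ x y → x ∼ y ≡ y ∼ x
  ∼-sym (u , o) (v , o′) =
    cong₂ _∧_ (cong₂ _∧_ (adj-sym u v) (⌊≟⌋-sym _ _)) (⌊≟⌋-sym (flag o) (flag o′))

  ∼-part : ∀ u o o′ → (u , o) ∼ (u , o′) ≡ false
  ∼-part u o o′ rewrite adj-irrefl u = refl

  deg≤d : ∀ x → ∑[ v < n ] ∑[ o < 2 * t ] ⟦ x ∼ (v , o) ⟧ ≤ d
  deg≤d (u , o) = begin
    ∑[ v < n ] ∑[ o′ < 2 * t ] ⟦ (u , o) ∼ (v , o′) ⟧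
      ≡⟨ sum-cong-≗ (λ v → ∑-combine 2 t (λ o′ → ⟦ (u , o) ∼ (v , o′) ⟧)) ⟩
    ∑[ v < n ] ∑[ g < 2 ] ∑[ j < t ] ⟦ (u , o) ∼ (v , combine g j) ⟧
      ≡⟨ sum-cong-≗ (λ v → sum-cong-≗ (λ g → sum-cong-≗ (λ j →
           cong (λ (g′ , j′) → ⟦ same v j′ ∧ ⌊ flag o ≟ g′ ⌋ ⟧) (remQuot-combine g j)))) ⟩
    ∑[ v < n ] ∑[ g < 2 ] ∑[ j < t ] ⟦ same v j ∧ ⌊ flag o ≟ g ⌋ ⟧
      ≡⟨ sum-cong-≗ (λ v → ∑-comm (λ g j → ⟦ same v j ∧ ⌊ flag o ≟ g ⌋ ⟧)) ⟩
    ∑[ v < n ] ∑[ j < t ] ∑[ g < 2 ] ⟦ same v j ∧ ⌊ flag o ≟ g ⌋ ⟧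
      ≡⟨ sum-cong-≗ (λ v → sum-cong-≗ (λ j → ∑-select (same v j) (flag o))) ⟩
    ∑[ v < n ] ∑[ j < t ] ⟦ same v j ⟧
      ≤⟨ ∑-mono-≤ (λ v → ∑-mono-≤ (λ j → ⟦⟧-mono (same⇒same⊠ v j))) ⟩
    ∑[ v < n ] ∑[ j < t ] ⟦ same⊠ v j ⟧
      ≡⟨ sameColorDegree-⊠ G t c (combine u i) ⟨
    sameColorDegree (G ⊠K t) c (combine u i)
      ≤⟨ c-def (combine u i) ⟩
    d ∎
    where
    open ≤-Reasoning
    i : Fin t
    i = copy o
    same : Fin n → Fin t → Bool
    same v j = adj G u v ∧ ⌊ c (combine u i) ≟ c (combine v j) ⌋
    same⊠ : Fin n → Fin t → Bool
    same⊠ v j = adj (G ⊠K t) (combine u i) (combine v j) ∧ ⌊ c (combine u i) ≟ c (combine v j) ⌋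
    same⇒same⊠ : ∀ v j → same v j ≡ true → same⊠ v j ≡ true
    same⇒same⊠ v j s rewrite adj-⊠ G t u v i j = weaken (⌊ u ≟ v ⌋ ∧ not ⌊ i ≟ j ⌋) s
      where
      weaken : ∀ {a s} b → a ∧ s ≡ true → (b ∨ a) ∧ s ≡ true
      weaken {true} true  refl = refl
      weaken {true} false refl = refl

  open IndependentTransversal _∼_ ∼-sym ∼-part deg≤d
         (+-mono-≤ d≤t (≤-trans d≤t (m≤m+n t 0))) (≤-trans 0<t (m≤m+n t _))

  F : Fin n → Fin (2 * t)
  F = proj₁ independent-transversal

  colour : Fin n → Fin (2 * b)
  colour u = combine (flag (F u)) (shade (u , F u))

  proper : IsProperColoring G (2 * b) colour
  proper u v uv same-colour =
    contradiction (trans (sym (proj₂ independent-transversal u v)) conflict) λ ()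
    where
    same-flag : flag (F u) ≡ flag (F v)
    same-flag = combine-injectiveˡ (flag (F u)) (shade (u , F u)) _ (shade (v , F v)) same-colour
    same-shade : shade (u , F u) ≡ shade (v , F v)
    same-shade = combine-injectiveʳ (flag (F u)) (shade (u , F u)) (flag (F v)) _ same-colour
    conflict : (u , F u) ∼ (v , F v) ≡ true
    conflict = cong₂ _∧_ (cong₂ _∧_ uv (≡⇒⌊≟⌋ same-shade)) (≡⇒⌊≟⌋ same-flag)

theorem2 : (G : Graph) → IsSimple G → (d : ℕ) → 1 ≤ d →
    (a b c : ℕ) → IsChromaticNumber G a →
    IsDefectiveChromaticNumber d (G ⊠K d) b →
    IsDefectiveChromaticNumber d (G ⊠K suc d) c →
    (a ≤ 2 * b) × (2 * b ≤ 2 * c)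
theorem2 G simple d 1≤d a b c (_ , a-minimal) (b-colorable , b-minimal) (c-colorable , _) =
  a-minimal (2 * b) (defColorable-⊠K⇒colorable G simple d d b ≤-refl 1≤d b-colorable) ,
  *-monoʳ-≤ 2 (b-minimal c (defColorable-⊠K-mono d G d c c-colorable))
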